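{- Let $k$ and $r$ be positive integers with $k\geq 2$ and $1\leq r<k-1$, let $D$ be the diameter of $K(2k+r,k)$, and let $p\geq 1$ be an integer with $2p\leq D$ such that $2p<D$ or $r$ divides $k-1$. Let $A$ and $B$ be two distinct, non-adjacent vertices of $K_{=2p}(2k+r,k)$ and let $s=|A\cap B|$. If $s\geq k-rp+r$ then the distance between $A$ and $B$ in $K_{=2p}(2k+r,k)$ is $2$. Otherwise, if $0\leq s<k-rp$, then this distance is at most $\lceil (k-s)/(rp)\rceil$.
   Context: For positive integers $n,k$, $[n]^k$ is the set of $k$-element subsets of $\{1,\dots,n\}$. The Kneser graph $K(2k+r,k)$ has vertex set $[2k+r]^k$, with $A,B$ adjacent iff $A\cap B=\emptyset$; it is connected. For a connected graph $G$ and positive integer $d$, the exact distance-$d$ graph $G_{=d}$ has the same vertex set as $G$, with two vertices adjacent iff their distance in $G$ is exactly $d$. $K_{=d}(2k+r,k)$ denotes the exact distance-$d$ graph of $K(2k+r,k)$. (The diameter of $K(2k+r,k)$ is $\lceil (k-1)/r\rceil+1$.) -}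

module Defs where

open import Level using (Level; _⊔_) renaming (suc to lsuc)
open import Data.Nat using (ℕ; zero; suc; _+_; _*_; _<_; _≤_; _∸_)
open import Data.Nat.DivMod using (_/_)
open import Data.Product using (Σ; ∃; ∃-syntax; _×_; _,_; proj₁)
open import Data.Fin.Subset using (Subset; ∣_∣; _∩_; Empty)
open import Relation.Binary.PropositionalEquality using (_≡_)
open import Relation.Nullary using (¬_)

data Walk {a ℓ : Level} {V : Set a} (Adj : V → V → Set ℓ) : ℕ → V → V → Set (a ⊔ ℓ) where
  [] : ∀ {x} → Walk Adj 0 x x
  _∷_ : ∀ {m x y z} → Adj x y → Walk Adj m y z → Walk Adj (suc m) x z

Dist : {a ℓ : Level} {V : Set a} (Adj : V → V → Set ℓ) → V → V → ℕ → Set (a ⊔ ℓ)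
Dist Adj x y d = Walk Adj d x y × (∀ m → m < d → ¬ Walk Adj m x y)

DistLe : {a ℓ : Level} {V : Set a} (Adj : V → V → Set ℓ) → V → V → ℕ → Set (a ⊔ ℓ)
DistLe Adj x y c = ∃[ m ] (m ≤ c × Walk Adj m x y)

IsDiameter : {a ℓ : Level} {V : Set a} (Adj : V → V → Set ℓ) → ℕ → Set (a ⊔ ℓ)
IsDiameter {V = V} Adj D = (∀ (x y : V) → DistLe Adj x y D) × ∃[ x ] ∃[ y ] Dist Adj x y D

ExactDist : {a ℓ : Level} {V : Set a} (Adj : V → V → Set ℓ) → ℕ → V → V → Set (a ⊔ ℓ)
ExactDist Adj d x y = Dist Adj x y d

KVertex : ℕ → ℕ → Set
KVertex n k = Σ (Subset n) (λ S → ∣ S ∣ ≡ k)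

KAdj : {n k : ℕ} → KVertex n k → KVertex n k → Set
KAdj (A , _) (B , _) = Empty (A ∩ B)

-- Ceiling of a / b (b > 0); value 0 when b = 0 (never used).
ceilDiv : ℕ → ℕ → ℕ
ceilDiv a zero = 0
ceilDiv a (suc b) = (a + b) / suc b

-- Write s = |X ∩ Y| for vertices X, Y of K(2k + r, k). The neighbours of X meet Y in at most
-- k − s and at least k − s − r elements, and every value in between occurs. Hence X and Y are
-- joined by a walk of length 2j iff s ≥ k − rj, and by one of length 2j + 1 iff s ≤ rj; so
-- when r(2p − 1) < k, which is what the hypotheses on the diameter provide, vertices meeting
-- in exactly k − rp elements are at distance exactly 2p. Prescribing how many elements of a new
-- vertex lie in A ∩ B, A ∖ B, B ∖ A and outside A ∪ B then yields a common K_{=2p}-neighbour of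
-- A and B when s ≥ k − rp + r; otherwise each K_{=2p}-step can move rp elements of A ∖ B into
-- B, until |A ∖ B| ≤ 2rp and two final steps reach B.
module Submission where

open import Defs
open import Data.Empty using (⊥-elim)
open import Data.Fin using (zero; suc)
open import Data.Fin.Subset using (Subset; inside; outside; ∁; _∩_; ∣_∣; Empty)
open import Data.Fin.Subset.Properties
  using (drop-∷-Empty; Empty-unique; ∣⊥∣≡0; ∣∁p∣≡n∸∣p∣; ∣p∩q∣≤∣p∣; ∩-comm; ∩-idem)
open import Data.Nat using (ℕ; zero; suc; _+_; _*_; _∸_; _<_; _≤_; z≤n; s≤s; s≤s⁻¹; z<s; _≤?_; NonZero)
open import Data.Nat.Divisibility using (_∣_; divides)
open import Data.Nat.DivMod using (_/_; _%_; m≡m%n+[m/n]*n; m%n<n)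
open import Data.Nat.Properties
open import Algebra.Properties.CommutativeSemigroup +-commutativeSemigroup
  using (x∙yz≈y∙zx; x∙yz≈z∙xy; x∙yz≈xz∙y; xy∙z≈y∙xz; xy∙z≈x∙zy; xy∙z≈xz∙y; xy∙z≈yz∙x)
open import Data.Product using (_×_; _,_; proj₁; proj₂; ∃-syntax)
open import Data.Sum using (_⊎_; inj₁; inj₂)
open import Data.Vec.Base using ([]; _∷_; here; there)
open import Relation.Binary.PropositionalEquality
  using (_≡_; _≢_; refl; sym; trans; cong; cong₂; subst; subst₂; module ≡-Reasoning)
open import Relation.Nullary using (¬_; yes; no)

∣p∣≡0⇒Empty : ∀ {n} (p : Subset n) → ∣ p ∣ ≡ 0 → Empty p
∣p∣≡0⇒Empty []            _      (() , _)
∣p∣≡0⇒Empty (inside  ∷ p) ()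
∣p∣≡0⇒Empty (outside ∷ p) ∣p∣≡0 (suc i , there i∈p) = ∣p∣≡0⇒Empty p ∣p∣≡0 (i , i∈p)

∣p∩q∣+∣p∩∁q∣≡∣p∣ : ∀ {n} (p q : Subset n) → ∣ p ∩ q ∣ + ∣ p ∩ ∁ q ∣ ≡ ∣ p ∣
∣p∩q∣+∣p∩∁q∣≡∣p∣ []            []            = refl
∣p∩q∣+∣p∩∁q∣≡∣p∣ (inside  ∷ p) (inside  ∷ q) = cong suc (∣p∩q∣+∣p∩∁q∣≡∣p∣ p q)
∣p∩q∣+∣p∩∁q∣≡∣p∣ (inside  ∷ p) (outside ∷ q) = trans (+-suc _ _) (cong suc (∣p∩q∣+∣p∩∁q∣≡∣p∣ p q))
∣p∩q∣+∣p∩∁q∣≡∣p∣ (outside ∷ p) (_       ∷ q) = ∣p∩q∣+∣p∩∁q∣≡∣p∣ p q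

∣p∩s∣+∣q∩s∣+∣∁p∩∁q∩s∣≡∣s∣ : ∀ {n} (p q s : Subset n) → Empty (p ∩ q) →
                             ∣ p ∩ s ∣ + ∣ q ∩ s ∣ + ∣ (∁ p ∩ ∁ q) ∩ s ∣ ≡ ∣ s ∣
∣p∩s∣+∣q∩s∣+∣∁p∩∁q∩s∣≡∣s∣ [] [] [] _ = refl
∣p∩s∣+∣q∩s∣+∣∁p∩∁q∩s∣≡∣s∣ (inside ∷ p) (inside ∷ q) s p∩q=∅ = ⊥-elim (p∩q=∅ (zero , here))
∣p∩s∣+∣q∩s∣+∣∁p∩∁q∩s∣≡∣s∣ (inside ∷ p) (outside ∷ q) (inside ∷ s) p∩q=∅ =
  cong suc (∣p∩s∣+∣q∩s∣+∣∁p∩∁q∩s∣≡∣s∣ p q s (drop-∷-Empty p∩q=∅))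
∣p∩s∣+∣q∩s∣+∣∁p∩∁q∩s∣≡∣s∣ (inside ∷ p) (outside ∷ q) (outside ∷ s) p∩q=∅ =
  ∣p∩s∣+∣q∩s∣+∣∁p∩∁q∩s∣≡∣s∣ p q s (drop-∷-Empty p∩q=∅)
∣p∩s∣+∣q∩s∣+∣∁p∩∁q∩s∣≡∣s∣ (outside ∷ p) (inside ∷ q) (inside ∷ s) p∩q=∅ =
  trans (cong (_+ ∣ (∁ p ∩ ∁ q) ∩ s ∣) (+-suc ∣ p ∩ s ∣ ∣ q ∩ s ∣))
    (cong suc (∣p∩s∣+∣q∩s∣+∣∁p∩∁q∩s∣≡∣s∣ p q s (drop-∷-Empty p∩q=∅)))
∣p∩s∣+∣q∩s∣+∣∁p∩∁q∩s∣≡∣s∣ (outside ∷ p) (inside ∷ q) (outside ∷ s) p∩q=∅ =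
  ∣p∩s∣+∣q∩s∣+∣∁p∩∁q∩s∣≡∣s∣ p q s (drop-∷-Empty p∩q=∅)
∣p∩s∣+∣q∩s∣+∣∁p∩∁q∩s∣≡∣s∣ (outside ∷ p) (outside ∷ q) (inside ∷ s) p∩q=∅ =
  trans (+-suc (∣ p ∩ s ∣ + ∣ q ∩ s ∣) ∣ (∁ p ∩ ∁ q) ∩ s ∣)
    (cong suc (∣p∩s∣+∣q∩s∣+∣∁p∩∁q∩s∣≡∣s∣ p q s (drop-∷-Empty p∩q=∅)))
∣p∩s∣+∣q∩s∣+∣∁p∩∁q∩s∣≡∣s∣ (outside ∷ p) (outside ∷ q) (outside ∷ s) p∩q=∅ =
  ∣p∩s∣+∣q∩s∣+∣∁p∩∁q∩s∣≡∣s∣ p q s (drop-∷-Empty p∩q=∅)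

choose-from-regions : ∀ {n} (p q : Subset n) {c a b e : ℕ} →
  c ≤ ∣ p ∩ q ∣ → a ≤ ∣ p ∩ ∁ q ∣ → b ≤ ∣ ∁ p ∩ q ∣ → e ≤ ∣ ∁ p ∩ ∁ q ∣ →
  ∃[ s ] ∣ s ∣ ≡ c + a + b + e × ∣ p ∩ s ∣ ≡ c + a × ∣ s ∩ q ∣ ≡ c + b
choose-from-regions [] [] z≤n z≤n z≤n z≤n = [] , refl , refl , refl
choose-from-regions (inside ∷ p) (inside ∷ q) {zero} _ a≤ b≤ e≤ =
  let s , ∣s∣ , ∣p∩s∣ , ∣s∩q∣ = choose-from-regions p q z≤n a≤ b≤ e≤
  in outside ∷ s , ∣s∣ , ∣p∩s∣ , ∣s∩q∣
choose-from-regions (inside ∷ p) (inside ∷ q) {suc c} (s≤s c≤) a≤ b≤ e≤ =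
  let s , ∣s∣ , ∣p∩s∣ , ∣s∩q∣ = choose-from-regions p q c≤ a≤ b≤ e≤
  in inside ∷ s , cong suc ∣s∣ , cong suc ∣p∩s∣ , cong suc ∣s∩q∣
choose-from-regions (inside ∷ p) (outside ∷ q) {a = zero} c≤ _ b≤ e≤ =
  let s , ∣s∣ , ∣p∩s∣ , ∣s∩q∣ = choose-from-regions p q c≤ z≤n b≤ e≤
  in outside ∷ s , ∣s∣ , ∣p∩s∣ , ∣s∩q∣
choose-from-regions (inside ∷ p) (outside ∷ q) {c} {suc a} c≤ (s≤s a≤) b≤ e≤ rewrite +-suc c a =
  let s , ∣s∣ , ∣p∩s∣ , ∣s∩q∣ = choose-from-regions p q c≤ a≤ b≤ e≤
  in inside ∷ s , cong suc ∣s∣ , cong suc ∣p∩s∣ , ∣s∩q∣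
choose-from-regions (outside ∷ p) (inside ∷ q) {b = zero} c≤ a≤ _ e≤ =
  let s , ∣s∣ , ∣p∩s∣ , ∣s∩q∣ = choose-from-regions p q c≤ a≤ z≤n e≤
  in outside ∷ s , ∣s∣ , ∣p∩s∣ , ∣s∩q∣
choose-from-regions (outside ∷ p) (inside ∷ q) {c} {a} {suc b} c≤ a≤ (s≤s b≤) e≤
  rewrite +-suc (c + a) b | +-suc c b =
  let s , ∣s∣ , ∣p∩s∣ , ∣s∩q∣ = choose-from-regions p q c≤ a≤ b≤ e≤
  in inside ∷ s , cong suc ∣s∣ , ∣p∩s∣ , cong suc ∣s∩q∣
choose-from-regions (outside ∷ p) (outside ∷ q) {e = zero} c≤ a≤ b≤ _ =
  let s , ∣s∣ , ∣p∩s∣ , ∣s∩q∣ = choose-from-regions p q c≤ a≤ b≤ z≤n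
  in outside ∷ s , ∣s∣ , ∣p∩s∣ , ∣s∩q∣
choose-from-regions (outside ∷ p) (outside ∷ q) {c} {a} {b} {suc e} c≤ a≤ b≤ (s≤s e≤)
  rewrite +-suc (c + a + b) e =
  let s , ∣s∣ , ∣p∩s∣ , ∣s∩q∣ = choose-from-regions p q c≤ a≤ b≤ e≤
  in inside ∷ s , cong suc ∣s∣ , ∣p∩s∣ , ∣s∩q∣

castWalk : ∀ {a ℓ} {V : Set a} {Adj : V → V → Set ℓ} {m n x y} → m ≡ n → Walk Adj m x y → Walk Adj n x y
castWalk refl w = w

walk₀⇒≡ : ∀ {a ℓ} {V : Set a} {Adj : V → V → Set ℓ} {x y} → Walk Adj 0 x y → x ≡ y
walk₀⇒≡ [] = refl

walk₁⇒Adj : ∀ {a ℓ} {V : Set a} {Adj : V → V → Set ℓ} {x y} → Walk Adj 1 x y → Adj x y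
walk₁⇒Adj (x~y ∷ []) = x~y

data Parity : ℕ → Set where
  even : ∀ j → Parity (2 * j)
  odd  : ∀ j → Parity (suc (2 * j))

parity : ∀ m → Parity m
parity zero = even 0
parity (suc m) with parity m
... | even j = odd j
... | odd  j = subst Parity (*-suc 2 j) (even (suc j))

r∣n⇒r*a<n⇒r*[1+a]≤n : ∀ {r n} a → r ∣ n → r * a < n → r * suc a ≤ n
r∣n⇒r*a<n⇒r*[1+a]≤n {r} a (divides c refl) r*a<c*r =
  subst (r * suc a ≤_) (*-comm r c) (*-monoʳ-≤ r (*-cancelˡ-< r a c (subst (r * a <_) (*-comm c r) r*a<c*r)))

m≤ceilDiv*n : ∀ m n .{{_ : NonZero n}} → m ≤ ceilDiv m n * n
m≤ceilDiv*n m (suc n) = +-cancelʳ-≤ n m _ (begin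
  m + n                                     ≡⟨ m≡m%n+[m/n]*n (m + n) (suc n) ⟩
  (m + n) % suc n + (m + n) / suc n * suc n ≤⟨ +-monoˡ-≤ _ (s≤s⁻¹ (m%n<n (m + n) (suc n))) ⟩
  n + (m + n) / suc n * suc n               ≡⟨ +-comm n _ ⟩
  (m + n) / suc n * suc n + n               ∎)
  where open ≤-Reasoning

module Kneser (k r : ℕ) where

  Vertex : Set
  Vertex = KVertex (2 * k + r) k

  _~_ : Vertex → Vertex → Set
  _~_ = KAdj

  meet : Vertex → Vertex → ℕ
  meet X Y = ∣ proj₁ X ∩ proj₁ Y ∣

  gap : Vertex → Vertex → ℕ
  gap X Y = ∣ proj₁ X ∩ ∁ (proj₁ Y) ∣

  meet+gap≡k : ∀ X Y → meet X Y + gap X Y ≡ k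
  meet+gap≡k (X , ∣X∣≡k) (Y , _) = trans (∣p∩q∣+∣p∩∁q∣≡∣p∣ X Y) ∣X∣≡k

  k∸meet≡gap : ∀ X Y → k ∸ meet X Y ≡ gap X Y
  k∸meet≡gap X Y = trans (cong (_∸ meet X Y) (sym (meet+gap≡k X Y))) (m+n∸m≡n (meet X Y) (gap X Y))

  gap≤k : ∀ X Y → gap X Y ≤ k
  gap≤k X Y = subst (gap X Y ≤_) (meet+gap≡k X Y) (m≤n+m _ _)

  meet-self : ∀ X → meet X X ≡ k
  meet-self (X , ∣X∣≡k) = trans (cong ∣_∣ (∩-idem X)) ∣X∣≡k

  ∣∁X∩Y∣≡gap : ∀ X Y → ∣ ∁ (proj₁ X) ∩ proj₁ Y ∣ ≡ gap X Y
  ∣∁X∩Y∣≡gap X Y = +-cancelˡ-≡ (meet X Y) _ _ (begin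
    meet X Y + ∣ ∁ (proj₁ X) ∩ proj₁ Y ∣
      ≡⟨ cong₂ _+_ (cong ∣_∣ (∩-comm (proj₁ X) (proj₁ Y))) (cong ∣_∣ (∩-comm (∁ (proj₁ X)) (proj₁ Y))) ⟩
    meet Y X + gap Y X ≡⟨ meet+gap≡k Y X ⟩
    k                  ≡⟨ meet+gap≡k X Y ⟨
    meet X Y + gap X Y ∎)
    where open ≡-Reasoning

  ∣∁X∣≡k+r : (X : Vertex) → ∣ ∁ (proj₁ X) ∣ ≡ k + r
  ∣∁X∣≡k+r (X , ∣X∣≡k) = begin
    ∣ ∁ X ∣             ≡⟨ ∣∁p∣≡n∸∣p∣ X ⟩
    2 * k + r ∸ ∣ X ∣   ≡⟨ cong (2 * k + r ∸_) ∣X∣≡k ⟩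
    2 * k + r ∸ k       ≡⟨ cong (_∸ k) (+-assoc k (k + 0) r) ⟩
    k + (k + 0 + r) ∸ k ≡⟨ m+n∸m≡n k (k + 0 + r) ⟩
    k + 0 + r           ≡⟨ cong (_+ r) (+-identityʳ k) ⟩
    k + r               ∎
    where open ≡-Reasoning

  ∣∁X∩∁Y∣≡meet+r : ∀ X Y → ∣ ∁ (proj₁ X) ∩ ∁ (proj₁ Y) ∣ ≡ meet X Y + r
  ∣∁X∩∁Y∣≡meet+r X Y = +-cancelˡ-≡ (gap X Y) _ _ (begin
    gap X Y + ∣ ∁ (proj₁ X) ∩ ∁ (proj₁ Y) ∣                 ≡⟨ cong (_+ ∣ ∁ (proj₁ X) ∩ ∁ (proj₁ Y) ∣) (∣∁X∩Y∣≡gap X Y) ⟨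
    ∣ ∁ (proj₁ X) ∩ proj₁ Y ∣ + ∣ ∁ (proj₁ X) ∩ ∁ (proj₁ Y) ∣ ≡⟨ ∣p∩q∣+∣p∩∁q∣≡∣p∣ (∁ (proj₁ X)) (proj₁ Y) ⟩
    ∣ ∁ (proj₁ X) ∣                                         ≡⟨ ∣∁X∣≡k+r X ⟩
    k + r                                                   ≡⟨ cong (_+ r) (meet+gap≡k X Y) ⟨
    meet X Y + gap X Y + r                                  ≡⟨ xy∙z≈y∙xz (meet X Y) (gap X Y) r ⟩
    gap X Y + (meet X Y + r)                                ∎)
    where open ≡-Reasoning

  vertex-with-meets : ∀ X Y {c a b e} →
    c ≤ meet X Y → a ≤ gap X Y → b ≤ gap X Y → e ≤ meet X Y + r → c + a + b + e ≡ k →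
    ∃[ Z ] meet X Z ≡ c + a × meet Z Y ≡ c + b
  vertex-with-meets X Y c≤ a≤ b≤ e≤ size =
    let Z , ∣Z∣ , X∩Z , Z∩Y = choose-from-regions (proj₁ X) (proj₁ Y) c≤ a≤
                                (subst (_ ≤_) (sym (∣∁X∩Y∣≡gap X Y)) b≤)
                                (subst (_ ≤_) (sym (∣∁X∩∁Y∣≡meet+r X Y)) e≤)
    in (Z , trans ∣Z∣ size) , X∩Z , Z∩Y

  neighbour-with-meet : ∀ X Y u → u ≤ gap X Y → gap X Y ≤ r + u → ∃[ N ] X ~ N × meet N Y ≡ u
  neighbour-with-meet X Y u u≤gap gap≤r+u =
    let N , X∩N , N∩Y = vertex-with-meets X Y {0} {0} {u} {k ∸ u} z≤n z≤n u≤gap k∸u≤meet+r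
                          (m+[n∸m]≡n (≤-trans u≤gap (gap≤k X Y)))
    in N , ∣p∣≡0⇒Empty _ X∩N , N∩Y
    where
    open ≤-Reasoning
    k∸u≤meet+r : k ∸ u ≤ meet X Y + r
    k∸u≤meet+r = m≤n+o⇒m∸n≤o k u (begin
      k                  ≡⟨ meet+gap≡k X Y ⟨
      meet X Y + gap X Y ≤⟨ +-monoʳ-≤ (meet X Y) gap≤r+u ⟩
      meet X Y + (r + u) ≡⟨ x∙yz≈z∙xy (meet X Y) r u ⟩
      u + (meet X Y + r) ∎)

  ~⇒meet≡0 : ∀ X X′ → X ~ X′ → meet X X′ ≡ 0
  ~⇒meet≡0 X X′ X~X′ = trans (cong ∣_∣ (Empty-unique X~X′)) (∣⊥∣≡0 (2 * k + r))

  ~⇒meet+meet≤k : ∀ X X′ Y → X ~ X′ → meet X Y + meet X′ Y ≤ k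
  ~⇒meet+meet≤k X X′ Y X~X′ = begin
    meet X Y + meet X′ Y                                             ≤⟨ m≤m+n _ _ ⟩
    meet X Y + meet X′ Y + ∣ (∁ (proj₁ X) ∩ ∁ (proj₁ X′)) ∩ proj₁ Y ∣
      ≡⟨ ∣p∩s∣+∣q∩s∣+∣∁p∩∁q∩s∣≡∣s∣ (proj₁ X) (proj₁ X′) (proj₁ Y) X~X′ ⟩
    ∣ proj₁ Y ∣                                                      ≡⟨ proj₂ Y ⟩
    k                                                                ∎
    where open ≤-Reasoning

  ~⇒k≤meet+meet+r : ∀ X X′ Y → X ~ X′ → k ≤ meet X Y + meet X′ Y + r
  ~⇒k≤meet+meet+r X X′ Y X~X′ = begin
    k                                                        ≡⟨ proj₂ Y ⟨
    ∣ proj₁ Y ∣                                              ≡⟨ ∣p∩s∣+∣q∩s∣+∣∁p∩∁q∩s∣≡∣s∣ (proj₁ X) (proj₁ X′) (proj₁ Y) X~X′ ⟨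
    meet X Y + meet X′ Y + ∣ (∁ (proj₁ X) ∩ ∁ (proj₁ X′)) ∩ proj₁ Y ∣
      ≤⟨ +-monoʳ-≤ (meet X Y + meet X′ Y) (∣p∩q∣≤∣p∣ (∁ (proj₁ X) ∩ ∁ (proj₁ X′)) (proj₁ Y)) ⟩
    meet X Y + meet X′ Y + ∣ ∁ (proj₁ X) ∩ ∁ (proj₁ X′) ∣     ≡⟨ cong (meet X Y + meet X′ Y +_) ∣∁X∩∁X′∣≡r ⟩
    meet X Y + meet X′ Y + r                                 ∎
    where
    open ≤-Reasoning
    ∣∁X∩∁X′∣≡r : ∣ ∁ (proj₁ X) ∩ ∁ (proj₁ X′) ∣ ≡ r
    ∣∁X∩∁X′∣≡r = trans (∣∁X∩∁Y∣≡meet+r X X′) (cong (_+ r) (~⇒meet≡0 X X′ X~X′))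

  even-walk⇒k≤meet+r*j : ∀ j {X Y} → Walk _~_ (2 * j) X Y → k ≤ meet X Y + r * j
  odd-walk⇒meet≤r*j    : ∀ j {X Y} → Walk _~_ (suc (2 * j)) X Y → meet X Y ≤ r * j

  even-walk⇒k≤meet+r*j zero {X} [] = subst (_≤ meet X X + r * 0) (meet-self X) (m≤m+n _ _)
  even-walk⇒k≤meet+r*j (suc j) {X} {Y} (_∷_ {y = X′} X~X′ w) = begin
    k                            ≤⟨ ~⇒k≤meet+meet+r X X′ Y X~X′ ⟩
    meet X Y + meet X′ Y + r     ≤⟨ +-monoˡ-≤ r (+-monoʳ-≤ (meet X Y) meet[X′,Y]≤r*j) ⟩
    meet X Y + r * j + r         ≡⟨ xy∙z≈x∙zy (meet X Y) (r * j) r ⟩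
    meet X Y + (r + r * j)       ≡⟨ cong (meet X Y +_) (*-suc r j) ⟨
    meet X Y + r * suc j         ∎
    where
    open ≤-Reasoning
    meet[X′,Y]≤r*j : meet X′ Y ≤ r * j
    meet[X′,Y]≤r*j = odd-walk⇒meet≤r*j j (castWalk (+-suc j (j + 0)) w)

  odd-walk⇒meet≤r*j j {X} {Y} (_∷_ {y = X′} X~X′ w) = +-cancelʳ-≤ (meet X′ Y) _ _ (begin
    meet X Y + meet X′ Y ≤⟨ ~⇒meet+meet≤k X X′ Y X~X′ ⟩
    k                    ≤⟨ even-walk⇒k≤meet+r*j j w ⟩
    meet X′ Y + r * j    ≡⟨ +-comm (meet X′ Y) (r * j) ⟩
    r * j + meet X′ Y    ∎)
    where open ≤-Reasoning

  even-walk : ∀ j X Y → k ≤ meet X Y + r * suc j → Walk _~_ (2 * suc j) X Y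
  odd-walk  : ∀ j X Y → meet X Y ≤ r * j → Walk _~_ (suc (2 * j)) X Y

  even-walk j X Y k≤meet+r*[1+j] =
    let N , X~N , N∩Y≡gap∸r = neighbour-with-meet X Y (gap X Y ∸ r) (m∸n≤m _ r) (m≤n+m∸n _ r)
    in castWalk (sym (*-suc 2 j)) (X~N ∷ odd-walk j N Y (subst (_≤ r * j) (sym N∩Y≡gap∸r) gap∸r≤r*j))
    where
    gap≤r*[1+j] : gap X Y ≤ r * suc j
    gap≤r*[1+j] = +-cancelˡ-≤ (meet X Y) _ _ (subst (_≤ meet X Y + r * suc j) (sym (meet+gap≡k X Y)) k≤meet+r*[1+j])
    gap∸r≤r*j : gap X Y ∸ r ≤ r * j
    gap∸r≤r*j = m≤n+o⇒m∸n≤o (gap X Y) r (subst (gap X Y ≤_) (*-suc r j) gap≤r*[1+j])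

  odd-walk zero X Y meet≤r*0 = ∣p∣≡0⇒Empty _ (n≤0⇒n≡0 (subst (meet X Y ≤_) (*-zeroʳ r) meet≤r*0)) ∷ []
  odd-walk (suc j) X Y meet≤r*[1+j] =
    let N , X~N , N∩Y≡gap = neighbour-with-meet X Y (gap X Y) ≤-refl (m≤n+m _ r)
    in X~N ∷ even-walk j N Y (begin
      k                      ≡⟨ meet+gap≡k X Y ⟨
      meet X Y + gap X Y     ≡⟨ +-comm (meet X Y) (gap X Y) ⟩
      gap X Y + meet X Y     ≤⟨ +-monoʳ-≤ (gap X Y) meet≤r*[1+j] ⟩
      gap X Y + r * suc j    ≡⟨ cong (_+ r * suc j) N∩Y≡gap ⟨
      meet N Y + r * suc j   ∎)
    where open ≤-Reasoning

  dist>2*[1+j]⇒meet+r*[1+j]<k : ∀ {X Y d} j → Dist _~_ X Y d → 2 * suc j < d → meet X Y + r * suc j < k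
  dist>2*[1+j]⇒meet+r*[1+j]<k {X} {Y} j (_ , no-shorter) 2[1+j]<d =
    ≰⇒> λ k≤ → no-shorter _ 2[1+j]<d (even-walk j X Y k≤)

  dist>1+2*j⇒r*j<meet : ∀ {X Y d} j → Dist _~_ X Y d → suc (2 * j) < d → r * j < meet X Y
  dist>1+2*j⇒r*j<meet {X} {Y} j (_ , no-shorter) 1+2j<d =
    ≰⇒> λ meet≤ → no-shorter _ 1+2j<d (odd-walk j X Y meet≤)

  diameter⇒r*q+r*[1+q]<k : ∀ {D} q → r + 1 < k → IsDiameter _~_ D → 2 * suc q ≤ D →
                            2 * suc q < D ⊎ r ∣ k ∸ 1 → r * q + r * suc q < k
  diameter⇒r*q+r*[1+q]<k zero r+1<k _ _ _ =
    subst (_< k) (sym (cong₂ _+_ (*-zeroʳ r) (*-identityʳ r))) (≤-<-trans (m≤m+n r 1) r+1<k)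
  diameter⇒r*q+r*[1+q]<k {D} (suc q′) _ (_ , x , y , dist) 2p≤D = λ where
      (inj₁ 2p<D)   → <-trans (+-monoˡ-< (r * suc q) r*q<t) (dist>2*[1+j]⇒meet+r*[1+j]<k q dist 2p<D)
      (inj₂ r∣k∸1) → begin-strict
        r * q + r * suc q ≡⟨ *-distribˡ-+ r q (suc q) ⟨
        r * (q + suc q)   ≡⟨ cong (r *_) (+-suc q q) ⟩
        r * suc (q + q)   ≤⟨ r∣n⇒r*a<n⇒r*[1+a]≤n (q + q) r∣k∸1 r*[q+q]<k∸1 ⟩
        k ∸ 1             <⟨ ∸-monoʳ-< z<s (≤-trans (s≤s z≤n) t+r*q<k) ⟩
        k                 ∎
    where
    open ≤-Reasoning
    q = suc q′
    t = meet x y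
    1+2q<2p : suc (2 * q) < 2 * suc q
    1+2q<2p = subst (suc (2 * q) <_) (sym (*-suc 2 q)) (n<1+n (suc (2 * q)))
    r*q<t : r * q < t
    r*q<t = dist>1+2*j⇒r*j<meet q dist (<-≤-trans 1+2q<2p 2p≤D)
    t+r*q<k : t + r * q < k
    t+r*q<k = dist>2*[1+j]⇒meet+r*[1+j]<k q′ dist (<-≤-trans (<-trans (n<1+n (2 * q)) 1+2q<2p) 2p≤D)
    r*[q+q]<k∸1 : r * (q + q) < k ∸ 1
    r*[q+q]<k∸1 = begin-strict
      r * (q + q)   ≡⟨ *-distribˡ-+ r q q ⟩
      r * q + r * q <⟨ +-monoˡ-< (r * q) r*q<t ⟩
      t + r * q     ≤⟨ m+n≤o⇒m≤o∸n (t + r * q) (subst (_≤ k) (+-comm 1 (t + r * q)) t+r*q<k) ⟩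
      k ∸ 1         ∎

  module ExactDistance (q : ℕ) .{{_ : NonZero r}} (r*q+r*[1+q]<k : r * q + r * suc q < k) where

    p : ℕ
    p = suc q

    P : ℕ
    P = r * p

    _~2p_ : Vertex → Vertex → Set
    _~2p_ = ExactDist _~_ (2 * p)

    P<k : P < k
    P<k = ≤-<-trans (m≤n+m P (r * q)) r*q+r*[1+q]<k

    P+P<k+r : P + P < k + r
    P+P<k+r = begin-strict
      P + P         ≡⟨ cong (_+ P) (*-suc r q) ⟩
      r + r * q + P ≡⟨ xy∙z≈yz∙x r (r * q) P ⟩
      r * q + P + r <⟨ +-monoˡ-< r r*q+r*[1+q]<k ⟩
      k + r         ∎
      where open ≤-Reasoning

    meet+P≡k⇒~2p : ∀ X Y → meet X Y + P ≡ k → X ~2p Y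
    meet+P≡k⇒~2p X Y t+P≡k = even-walk q X Y (≤-reflexive (sym t+P≡k)) , no-shorter-walk
      where
      t = meet X Y
      no-shorter-walk : ∀ m → m < 2 * p → ¬ Walk _~_ m X Y
      no-shorter-walk m m<2p with parity m
      ... | even j = λ w → <⇒≱ t+r*j<k (even-walk⇒k≤meet+r*j j w)
        where
        t+r*j<k : t + r * j < k
        t+r*j<k = subst (t + r * j <_) t+P≡k (+-monoʳ-< t (*-monoʳ-< r (*-cancelˡ-< 2 j p m<2p)))
      ... | odd j = λ w → <⇒≱ r*q+r*[1+q]<k (subst (_≤ r * q + P) t+P≡k
                                      (+-monoˡ-≤ P (≤-trans (odd-walk⇒meet≤r*j j w) (*-monoʳ-≤ r j≤q))))
        where
        j≤q : j ≤ q
        j≤q = s≤s⁻¹ (*-cancelˡ-< 2 j p (<-trans (n<1+n (2 * j)) m<2p))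

    step-closer : ∀ X Y {a b e} → P + a ≡ gap X Y → b + e ≡ P → e ≤ meet X Y + r →
                 ∃[ Z ] X ~2p Z × gap Z Y + b ≡ gap X Y
    step-closer X Y {a} {b} {e} P+a≡gap b+e≡P e≤t+r =
      let Z , X∩Z , Z∩Y = vertex-with-meets X Y ≤-refl a≤gap b≤gap e≤t+r size
      in Z , meet+P≡k⇒~2p X Z (trans (cong (_+ P) X∩Z) t+a+P≡k) , gap-shrinks Z Z∩Y
      where
      open ≡-Reasoning
      t = meet X Y
      a≤gap : a ≤ gap X Y
      a≤gap = subst (a ≤_) P+a≡gap (m≤n+m a P)
      b≤gap : b ≤ gap X Y
      b≤gap = ≤-trans (subst (b ≤_) b+e≡P (m≤m+n b e)) (subst (P ≤_) P+a≡gap (m≤m+n P a))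
      t+a+P≡k : t + a + P ≡ k
      t+a+P≡k = begin
        t + a + P   ≡⟨ xy∙z≈x∙zy t a P ⟩
        t + (P + a) ≡⟨ cong (t +_) P+a≡gap ⟩
        t + gap X Y ≡⟨ meet+gap≡k X Y ⟩
        k           ∎
      size : t + a + b + e ≡ k
      size = trans (+-assoc (t + a) b e) (trans (cong (t + a +_) b+e≡P) t+a+P≡k)
      gap-shrinks : ∀ Z → meet Z Y ≡ t + b → gap Z Y + b ≡ gap X Y
      gap-shrinks Z Z∩Y = +-cancelˡ-≡ t _ _ (begin
        t + (gap Z Y + b)  ≡⟨ x∙yz≈xz∙y t (gap Z Y) b ⟩
        t + b + gap Z Y    ≡⟨ cong (_+ gap Z Y) Z∩Y ⟨
        meet Z Y + gap Z Y ≡⟨ meet+gap≡k Z Y ⟩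
        k                  ≡⟨ meet+gap≡k X Y ⟨
        t + gap X Y        ∎)

    two-step-walk : ∀ X Y → P < gap X Y → gap X Y ≤ P + P → Walk _~2p_ 2 X Y
    two-step-walk X Y P<gap gap≤2P =
      let a , P+a≡gap = m≤n⇒∃[o]m+o≡n (<⇒≤ P<gap)
          e , a+e≡P = m≤n⇒∃[o]m+o≡n (+-cancelˡ-≤ P a P (subst (_≤ P + P) (sym P+a≡gap) gap≤2P))
          Z , X~Z , gap[Z,Y]+a≡gap = step-closer X Y P+a≡gap a+e≡P (e≤t+r P+a≡gap a+e≡P)
      in X~Z ∷ meet+P≡k⇒~2p Z Y (meet+P≡k Z (+-cancelʳ-≡ a _ _ (trans gap[Z,Y]+a≡gap (sym P+a≡gap)))) ∷ []
      where
      t = meet X Y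
      meet+P≡k : ∀ Z → gap Z Y ≡ P → meet Z Y + P ≡ k
      meet+P≡k Z gap≡P = trans (cong (meet Z Y +_) (sym gap≡P)) (meet+gap≡k Z Y)
      e≤t+r : ∀ {a e} → P + a ≡ gap X Y → a + e ≡ P → e ≤ t + r
      e≤t+r {a} {e} P+a≡gap a+e≡P = <⇒≤ (+-cancelʳ-< (gap X Y) e (t + r) (begin-strict
        e + gap X Y     ≡⟨ cong (e +_) P+a≡gap ⟨
        e + (P + a)     ≡⟨ x∙yz≈y∙zx e P a ⟩
        P + (a + e)     ≡⟨ cong (P +_) a+e≡P ⟩
        P + P           <⟨ P+P<k+r ⟩
        k + r           ≡⟨ cong (_+ r) (meet+gap≡k X Y) ⟨
        t + gap X Y + r ≡⟨ xy∙z≈xz∙y t (gap X Y) r ⟩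
        t + r + gap X Y ∎))
        where open ≤-Reasoning

    step-closer-by-P : ∀ X Y → P + P < gap X Y → ∃[ Z ] X ~2p Z × gap Z Y + P ≡ gap X Y
    step-closer-by-P X Y 2P<gap =
      let a , P+a≡gap = m≤n⇒∃[o]m+o≡n (≤-trans (m≤m+n P P) (<⇒≤ 2P<gap))
      in step-closer X Y P+a≡gap (+-identityʳ P) z≤n

    gap≤c*P⇒dist≤c : ∀ c X Y → P < gap X Y → gap X Y ≤ c * P → DistLe _~2p_ X Y c
    gap≤c*P⇒dist≤c zero    X Y P<gap gap≤0    = ⊥-elim (<⇒≱ P<gap (≤-trans gap≤0 z≤n))
    gap≤c*P⇒dist≤c (suc c) X Y P<gap gap≤[1+c]*P with gap X Y ≤? P + P
    ... | yes gap≤2P = 2 , 2≤1+c , two-step-walk X Y P<gap gap≤2P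
      where
      2≤1+c : 2 ≤ suc c
      2≤1+c = *-cancelʳ-< P 1 (suc c) (subst (_< suc c * P) (sym (*-identityˡ P)) (<-≤-trans P<gap gap≤[1+c]*P))
    ... | no  gap≰2P =
      let Z , X~Z , gap[Z,Y]+P≡gap = step-closer-by-P X Y (≰⇒> gap≰2P)
          l , l≤c , w = gap≤c*P⇒dist≤c c Z Y
                          (+-cancelʳ-< P P (gap Z Y) (subst (P + P <_) (sym gap[Z,Y]+P≡gap) (≰⇒> gap≰2P)))
                          (+-cancelʳ-≤ P (gap Z Y) (c * P)
                            (subst₂ _≤_ (sym gap[Z,Y]+P≡gap) (+-comm P (c * P)) gap≤[1+c]*P))
      in suc l , s≤s l≤c , X~Z ∷ w

    dist≡2 : ∀ A B → proj₁ A ≢ proj₁ B → ¬ A ~2p B → k + r ≤ meet A B + P → Dist _~2p_ A B 2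
    dist≡2 A B A≢B ¬A~B k+r≤s+P =
      let C , A∩C , C∩B = vertex-with-meets A B {k ∸ P} {0} {0} {P} k∸P≤s z≤n z≤n P≤s+r size
      in (meet+P≡k⇒~2p A C (trans (cong (_+ P) A∩C) k∸P+0+P≡k)
         ∷ meet+P≡k⇒~2p C B (trans (cong (_+ P) C∩B) k∸P+0+P≡k) ∷ []) , no-shorter-walk
      where
      s = meet A B
      k∸P+0+P≡k : k ∸ P + 0 + P ≡ k
      k∸P+0+P≡k = trans (cong (_+ P) (+-identityʳ (k ∸ P))) (m∸n+n≡m (<⇒≤ P<k))
      size : k ∸ P + 0 + 0 + P ≡ k
      size = trans (cong (_+ P) (+-identityʳ (k ∸ P + 0))) k∸P+0+P≡k
      k∸P≤s : k ∸ P ≤ s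
      k∸P≤s = m≤n+o⇒m∸n≤o k P (subst (k ≤_) (+-comm s P) (≤-trans (m≤m+n k r) k+r≤s+P))
      P≤s+r : P ≤ s + r
      P≤s+r = ≤-trans (+-cancelʳ-≤ P P s (≤-trans (<⇒≤ P+P<k+r) k+r≤s+P)) (m≤m+n s r)
      no-shorter-walk : ∀ m → m < 2 → ¬ Walk _~2p_ m A B
      no-shorter-walk zero          _                   w = A≢B (cong proj₁ (walk₀⇒≡ w))
      no-shorter-walk (suc zero)    _                   w = ¬A~B (walk₁⇒Adj w)
      no-shorter-walk (suc (suc m)) (s≤s (s≤s ()))

mainTheorem7 : (k r D p : ℕ) → 2 ≤ k → 1 ≤ r → r + 1 < k →
    IsDiameter (KAdj {2 * k + r} {k}) D →
    1 ≤ p → 2 * p ≤ D → (2 * p < D ⊎ r ∣ k ∸ 1) →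
    (A B : KVertex (2 * k + r) k) → proj₁ A ≢ proj₁ B →
    ¬ ExactDist (KAdj {2 * k + r} {k}) (2 * p) A B →
    (k + r ≤ ∣ proj₁ A ∩ proj₁ B ∣ + r * p →
      Dist (ExactDist (KAdj {2 * k + r} {k}) (2 * p)) A B 2)
    × (∣ proj₁ A ∩ proj₁ B ∣ + r * p < k →
      DistLe (ExactDist (KAdj {2 * k + r} {k}) (2 * p)) A B (ceilDiv (k ∸ ∣ proj₁ A ∩ proj₁ B ∣) (r * p)))
-- The cases r = 0 and p = 0 are refuted by 1 ≤ r and 1 ≤ p; 2 ≤ k already follows from r + 1 < k.
mainTheorem7 k r@(suc _) D (suc q) _ _ r+1<k diameter _ 2p≤D 2p<D⊎r∣k∸1 A B A≢B ¬A~B =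
  dist≡2 A B A≢B ¬A~B , dist≤ceilDiv
  where
  open Kneser k r
  open ExactDistance q (diameter⇒r*q+r*[1+q]<k q r+1<k diameter 2p≤D 2p<D⊎r∣k∸1)
  dist≤ceilDiv : meet A B + P < k → DistLe _~2p_ A B (ceilDiv (k ∸ meet A B) P)
  dist≤ceilDiv s+P<k = gap≤c*P⇒dist≤c _ A B P<gap
    (subst (_≤ ceilDiv (k ∸ meet A B) P * P) (k∸meet≡gap A B) (m≤ceilDiv*n (k ∸ meet A B) P))
    where
    P<gap : P < gap A B
    P<gap = +-cancelˡ-< (meet A B) P (gap A B) (subst (meet A B + P <_) (sym (meet+gap≡k A B)) s+P<k)
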